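{- Let $n\ge 2$, $m\ge 4$, $k=\operatorname{Dist}(B_{m,n})$, and suppose $n<k^{m-2}-(k-1)^{m-2}$. Let $j$ be the smallest integer such that $n\le n^k_j$. Then $$|V(B_{m,n})|-N^k_j-1\ \le\ \rho^u(B_{m,n})\ <\ |V(B_{m,n})|-N^k_{j-1}-1,$$ where $|V(B_{m,n})|=2+n(m-2)$.
   Context: The book graph $B_{m,n}$ consists of $n$ copies of the cycle $C_m$ identified along a single common edge. A $d$-distinguishing coloring of a graph $G$ is an assignment of colors from a set of $d$ colors to the vertices such that the only automorphism mapping each color class to itself is the identity; $\operatorname{Dist}(G)$ is the least $d$ for which one exists. The paint cost $\rho^d(G)$ is the minimum of $|V(G)\setminus T|$ over all $d$-distinguishing colorings of $G$ and all their color classes $T$; the upper paint cost is $\rho^u(G)=\rho^{\operatorname{Dist}(G)}(G)$. For integers $j\ge0$ define $n^k_j=\sum_{i=0}^{j}\binom{m-2}{i}(k-1)^i$ and $N^k_j=\sum_{i=0}^{j}(m-2-i)\binom{m-2}{i}(k-1)^i$. -}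

module Defs where

open import Data.Nat using (ℕ; zero; suc; _+_; _*_; _∸_; _^_; _≤_; _<_)
open import Data.Nat.Combinatorics using (_C_)
open import Data.Fin using (Fin; zero; suc; toℕ; _≟_)
open import Data.List using (List; map; _++_; concatMap; filter; length; allFin)
open import Data.Product using (Σ; _×_; _,_)
open import Data.Sum using (_⊎_)
open import Function.Bundles using (_↔_; Inverse)
open import Relation.Nullary using (¬_; ¬?)
open import Relation.Binary.PropositionalEquality using (_≡_)

-- Vertices of the book graph B_{m,n}: two spine vertices (the common edge)
-- and, for each page i < n, the m-2 inner vertices of the i-th copy of C_m.
data Vtx (n m : ℕ) : Set where
  spine : Fin 2 → Vtx n m
  page  : Fin n → Fin (m ∸ 2) → Vtx n m

-- Directed edge list; page i is the cycle
-- spine 0 - page i 0 - page i 1 - ... - page i (m-3) - spine 1 - spine 0.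
data Edge {n m : ℕ} : Vtx n m → Vtx n m → Set where
  ss : Edge (spine zero) (spine (suc zero))
  sp : ∀ i p → toℕ p ≡ 0 → Edge (spine zero) (page i p)
  pp : ∀ i p q → toℕ q ≡ suc (toℕ p) → Edge (page i p) (page i q)
  ps : ∀ i p → suc (toℕ p) ≡ m ∸ 2 → Edge (page i p) (spine (suc zero))

Adj : {n m : ℕ} → Vtx n m → Vtx n m → Set
Adj x y = Edge x y ⊎ Edge y x

record Aut (n m : ℕ) : Set where
  field
    perm    : Vtx n m ↔ Vtx n m
    pres    : ∀ x y → Adj x y → Adj (Inverse.to perm x) (Inverse.to perm y)
    reflect : ∀ x y → Adj (Inverse.to perm x) (Inverse.to perm y) → Adj x y

app : {n m : ℕ} → Aut n m → Vtx n m → Vtx n m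
app σ = Inverse.to (Aut.perm σ)

Coloring : ℕ → ℕ → ℕ → Set
Coloring n m d = Vtx n m → Fin d

IsDistinguishing : {n m d : ℕ} → Coloring n m d → Set
IsDistinguishing {n} {m} c =
  (σ : Aut n m) → (∀ v → c (app σ v) ≡ c v) → ∀ v → app σ v ≡ v

HasDistColoring : ℕ → ℕ → ℕ → Set
HasDistColoring n m d = Σ (Coloring n m d) IsDistinguishing

IsDist : ℕ → ℕ → ℕ → Set
IsDist n m k = HasDistColoring n m k × (∀ d → d < k → ¬ HasDistColoring n m d)

allVtx : (n m : ℕ) → List (Vtx n m)
allVtx n m = map spine (allFin 2)
          ++ concatMap (λ i → map (page i) (allFin (m ∸ 2))) (allFin n)

outsideClass : {n m d : ℕ} → Coloring n m d → Fin d → ℕ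
outsideClass {n} {m} c i = length (filter (λ v → ¬? (c v ≟ i)) (allVtx n m))

IsPaintCost : ℕ → ℕ → ℕ → ℕ → Set
IsPaintCost n m d r =
  Σ (Coloring n m d) (λ c → Σ (Fin d) (λ i → IsDistinguishing c × outsideClass c i ≡ r))
  × (∀ (c : Coloring n m d) (i : Fin d) → IsDistinguishing c → r ≤ outsideClass c i)

smallN : ℕ → ℕ → ℕ → ℕ
smallN m k zero    = ((m ∸ 2) C 0) * (k ∸ 1) ^ 0
smallN m k (suc j) = smallN m k j + ((m ∸ 2) C suc j) * (k ∸ 1) ^ suc j

bigN : ℕ → ℕ → ℕ → ℕ
bigN m k zero    = (m ∸ 2 ∸ 0) * ((m ∸ 2) C 0) * (k ∸ 1) ^ 0
bigN m k (suc j) = bigN m k j + (m ∸ 2 ∸ suc j) * ((m ∸ 2) C suc j) * (k ∸ 1) ^ suc j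

numVtx : ℕ → ℕ → ℕ
numVtx n m = 2 + n * (m ∸ 2)

{-# OPTIONS --safe #-}
module Submission where

-- Read each page as the word of its colours, and call the number of its vertices outside the
-- colour class i its weight; there are C(m-2,x)(k-1)^x words of weight x.  In a distinguishing
-- colouring distinct pages carry distinct words, since transposing two equally coloured pages is
-- an automorphism.  Lower bound: if n ≤ n^k_j, a page of weight below j has deficit j − weight,
-- and the deficits of n distinct words add up to at most those of all words, which gives
-- |V ∖ T| ≥ |V| − N^k_j − 2.  The missing unit comes from a spine vertex outside T, or else from
-- n < n^k_j, from a page heavier than j, or from a page whose reversed word is unused; if none of
-- these happens, the page words are closed under reversal and reflecting the book is a
-- non-trivial colour-preserving automorphism.  Upper bound: colour the two spine vertices
-- differently and give the pages the words of weight < j, one word of weight j, and further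
-- distinct words; distinct spine colours and distinct page words leave only the identity.

open import Defs

open import Data.Bool using (true; false; if_then_else_)
open import Data.Empty using (⊥; ⊥-elim)
open import Data.Fin using (Fin; zero; suc; toℕ; opposite; fromℕ; fromℕ<; inject₁; _≟_)
open import Data.Fin.Induction using (<-weakInduction)
open import Data.Fin.Permutation using (Permutation′; _⟨$⟩ʳ_; _⟨$⟩ˡ_; inverseˡ; inverseʳ; transpose; permutation)
import Data.Fin.Permutation.Components as PC
open import Data.Fin.Properties
  using (any?; all?; ¬∀⟶∃¬; toℕ<n; toℕ-injective; toℕ-fromℕ; toℕ-inject₁; opposite-prop; opposite-involutive)
open import Data.List
  using (List; []; _∷_; _++_; map; concat; concatMap; filter; length; take; tabulate; allFin; cartesianProductWith)
open import Data.List.Properties using (length-++)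
open import Data.List.Membership.Propositional using (_∈_)
open import Data.List.Membership.Propositional.Properties
  using (∈-filter⁺; ∈-filter⁻; ∈-++⁺ˡ; ∈-++⁺ʳ; ∈-++⁻; ∈-∃++; ∈-cartesianProductWith⁺; ∈-allFin)
open import Data.List.Relation.Unary.Any using (here; there)
import Data.List.Relation.Unary.All as All
import Data.List.Relation.Unary.All.Properties as Allₚ
open import Data.List.Relation.Unary.AllPairs using ([]; _∷_)
open import Data.List.Relation.Unary.Unique.Propositional using (Unique)
open import Data.List.Relation.Unary.Unique.Propositional.Properties
  using (allFin⁺; cartesianProductWith⁺; tabulate⁺; ++⁺) renaming (filter⁺ to unique-filter⁺)
open import Data.Nat using (ℕ; zero; suc; _+_; _*_; _∸_; _^_; _≤_; _<_; z≤n; s≤s; s≤s⁻¹; _<?_)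
open import Data.Nat.Combinatorics using (_C_; nCk+nC[k+1]≡[n+1]C[k+1]; k>n⇒nCk≡0; nCn≡1)
open import Data.Nat.Properties hiding (_≟_)
open import Data.Nat.Properties using () renaming (_≟_ to _≟ℕ_)
open import Data.Nat.Solver using (module +-*-Solver)
open import Data.Product using (∃; _×_; _,_; proj₁; proj₂)
open import Data.Sum using (_⊎_; inj₁; inj₂)
open import Data.Vec using (Vec; []; _∷_; lookup)
import Data.Vec as Vec
open import Data.Vec.Properties using (∷-injective; lookup∘tabulate; tabulate∘lookup; tabulate-cong; ≡-dec)
open import Function using (_∘_; id)
open import Function.Bundles using (Injection; mk↔ₛ′)
open import Function.Properties.Inverse using (↔⇒↣)
open import Relation.Binary.Definitions using (tri<; tri≈; tri>)
open import Relation.Binary.PropositionalEquality hiding (J)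
open import Relation.Nullary using (¬_; Dec; yes; no; does; ¬?)
open import Relation.Nullary.Decidable using (dec-true; dec-false)
open import Relation.Unary using (Decidable)

open +-*-Solver using (solve; _:+_; _:*_; _:=_; con)

𝟙 : {P : Set} → Dec P → ℕ
𝟙 P? = if does P? then 1 else 0

if-does-true : ∀ {P A : Set} (P? : Dec P) {a b : A} → P → (if does P? then a else b) ≡ a
if-does-true P? p rewrite dec-true P? p = refl

if-does-false : ∀ {P A : Set} (P? : Dec P) {a b : A} → ¬ P → (if does P? then a else b) ≡ b
if-does-false P? ¬p rewrite dec-false P? ¬p = refl

𝟙-trichotomy : ∀ x y → 𝟙 (x <? y) + (𝟙 (x ≟ℕ y) + 𝟙 (y <? x)) ≡ 1
𝟙-trichotomy x y with <-cmp x y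
... | tri< x<y x≢y y≮x = cong₂ _+_ (if-does-true (x <? y) x<y) (cong₂ _+_ (if-does-false (x ≟ℕ y) x≢y) (if-does-false (y <? x) y≮x))
... | tri≈ x≮y x≡y y≮x = cong₂ _+_ (if-does-false (x <? y) x≮y) (cong₂ _+_ (if-does-true (x ≟ℕ y) x≡y) (if-does-false (y <? x) y≮x))
... | tri> x≮y x≢y y<x = cong₂ _+_ (if-does-false (x <? y) x≮y) (cong₂ _+_ (if-does-false (x ≟ℕ y) x≢y) (if-does-true (y <? x) y<x))

𝟙≤1 : {P : Set} (P? : Dec P) → 𝟙 P? ≤ 1
𝟙≤1 (yes _) = s≤s z≤n
𝟙≤1 (no _)  = z≤n

sumList : {A : Set} → (A → ℕ) → List A → ℕ
sumList f []       = 0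
sumList f (x ∷ xs) = f x + sumList f xs

sumFin : (n : ℕ) → (Fin n → ℕ) → ℕ
sumFin zero    f = 0
sumFin (suc n) f = f zero + sumFin n (f ∘ suc)

sumTo : ℕ → (ℕ → ℕ) → ℕ
sumTo zero    f = f 0
sumTo (suc b) f = sumTo b f + f (suc b)

infix 5 sumFin sumTo
syntax sumFin n (λ i → e) = ∑[ i < n ] e
syntax sumTo b (λ x → e) = ∑[ x ≤ b ] e

module _ {A : Set} where

  sumList-++ : ∀ (f : A → ℕ) xs ys → sumList f (xs ++ ys) ≡ sumList f xs + sumList f ys
  sumList-++ f []       ys = refl
  sumList-++ f (x ∷ xs) ys = trans (cong (f x +_) (sumList-++ f xs ys)) (sym (+-assoc (f x) _ _))

  sumList-cong : ∀ {f g : A → ℕ} xs → (∀ x → f x ≡ g x) → sumList f xs ≡ sumList g xs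
  sumList-cong []       f≗g = refl
  sumList-cong (x ∷ xs) f≗g = cong₂ _+_ (f≗g x) (sumList-cong xs f≗g)

  sumList-+ : ∀ (f g : A → ℕ) xs → sumList (λ x → f x + g x) xs ≡ sumList f xs + sumList g xs
  sumList-+ f g []       = refl
  sumList-+ f g (x ∷ xs) rewrite sumList-+ f g xs =
    solve 4 (λ a b c d → (a :+ b) :+ (c :+ d) := (a :+ c) :+ (b :+ d)) refl (f x) (g x) (sumList f xs) (sumList g xs)

  sumList-concat : ∀ (f : A → ℕ) xss → sumList f (concat xss) ≡ sumList (sumList f) xss
  sumList-concat f []         = refl
  sumList-concat f (xs ∷ xss) = trans (sumList-++ f xs (concat xss)) (cong (sumList f xs +_) (sumList-concat f xss))

  length-filter : ∀ {P : A → Set} (P? : Decidable P) xs → length (filter P? xs) ≡ sumList (𝟙 ∘ P?) xs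
  length-filter P? []       = refl
  length-filter P? (x ∷ xs) with does (P? x)
  ... | true  = cong suc (length-filter P? xs)
  ... | false = length-filter P? xs

  length-sumList : ∀ (xs : List A) → length xs ≡ sumList (λ _ → 1) xs
  length-sumList []       = refl
  length-sumList (x ∷ xs) = cong suc (length-sumList xs)

  sumList-filter : ∀ {P : A → Set} (P? : Decidable P) f xs →
                   sumList f (filter P? xs) ≡ sumList (λ x → if does (P? x) then f x else 0) xs
  sumList-filter P? f []       = refl
  sumList-filter P? f (x ∷ xs) with does (P? x)
  ... | true  = cong (f x +_) (sumList-filter P? f xs)
  ... | false = sumList-filter P? f xs

  sumList-take-++ : ∀ (f : A → ℕ) xs ys t → sumList f (take (length xs + t) (xs ++ ys)) ≡ sumList f xs + sumList f (take t ys)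
  sumList-take-++ f []       ys t = refl
  sumList-take-++ f (x ∷ xs) ys t = trans (cong (f x +_) (sumList-take-++ f xs ys t)) (sym (+-assoc (f x) _ _))

  sumList-take-≤ : ∀ (f : A → ℕ) {b} → (∀ x → f x ≤ b) → ∀ t xs → sumList f (take t xs) ≤ t * b
  sumList-take-≤ f f≤b zero    xs       = z≤n
  sumList-take-≤ f f≤b (suc t) []       = z≤n
  sumList-take-≤ f f≤b (suc t) (x ∷ xs) = +-mono-≤ (f≤b x) (sumList-take-≤ f f≤b t xs)

  sumList-mono-⊆ : ∀ (f : A → ℕ) {xs} ys → Unique xs → (∀ {x} → x ∈ xs → x ∈ ys) → sumList f xs ≤ sumList f ys
  sumList-mono-⊆ f {[]}     ys _           _    = z≤n
  sumList-mono-⊆ f {x ∷ xs} ys (x∉xs ∷ uxs) xs⊆ys with ∈-∃++ (xs⊆ys (here refl))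
  ... | as , bs , refl = begin
      f x + sumList f xs
    ≤⟨ +-monoʳ-≤ (f x) (sumList-mono-⊆ f (as ++ bs) uxs xs⊆as++bs) ⟩
      f x + sumList f (as ++ bs)
    ≡⟨ cong (f x +_) (sumList-++ f as bs) ⟩
      f x + (sumList f as + sumList f bs)
    ≡⟨ solve 3 (λ a b c → a :+ (b :+ c) := b :+ (a :+ c)) refl (f x) (sumList f as) (sumList f bs) ⟩
      sumList f as + (f x + sumList f bs)
    ≡⟨ sumList-++ f as (x ∷ bs) ⟨
      sumList f (as ++ x ∷ bs) ∎
    where
    open ≤-Reasoning
    xs⊆as++bs : ∀ {y} → y ∈ xs → y ∈ as ++ bs
    xs⊆as++bs y∈xs with ∈-++⁻ as (xs⊆ys (there y∈xs))
    ... | inj₁ y∈as         = ∈-++⁺ˡ y∈as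
    ... | inj₂ (here refl)  = ⊥-elim (All.lookup x∉xs y∈xs refl)
    ... | inj₂ (there y∈bs) = ∈-++⁺ʳ as y∈bs

lookupOr : {A : Set} → A → List A → ℕ → A
lookupOr d []       _       = d
lookupOr d (y ∷ ys) zero    = y
lookupOr d (y ∷ ys) (suc a) = lookupOr d ys a

module _ {A : Set} (d : A) where

  lookupOr-∈ : ∀ ys a → a < length ys → lookupOr d ys a ∈ ys
  lookupOr-∈ (y ∷ ys) zero    _         = here refl
  lookupOr-∈ (y ∷ ys) (suc a) (s≤s a<l) = there (lookupOr-∈ ys a a<l)

  lookupOr-injective : ∀ {ys} → Unique ys → ∀ {a b} → a < length ys → b < length ys → lookupOr d ys a ≡ lookupOr d ys b → a ≡ b
  lookupOr-injective {y ∷ ys} _            {zero}  {zero}  _         _         _  = refl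
  lookupOr-injective {y ∷ ys} (y∉ys ∷ _)   {zero}  {suc b} _         (s≤s b<l) eq = ⊥-elim (All.lookup y∉ys (lookupOr-∈ ys b b<l) eq)
  lookupOr-injective {y ∷ ys} (y∉ys ∷ _)   {suc a} {zero}  (s≤s a<l) _         eq = ⊥-elim (All.lookup y∉ys (lookupOr-∈ ys a a<l) (sym eq))
  lookupOr-injective {y ∷ ys} (_ ∷ unique) {suc a} {suc b} (s≤s a<l) (s≤s b<l) eq = cong suc (lookupOr-injective unique a<l b<l eq)

  sumFin-lookupOr : ∀ (f : A → ℕ) n ys → n ≤ length ys → sumFin n (f ∘ lookupOr d ys ∘ toℕ) ≡ sumList f (take n ys)
  sumFin-lookupOr f zero    ys       _         = refl
  sumFin-lookupOr f (suc n) (y ∷ ys) (s≤s n≤l) = cong (f y +_) (sumFin-lookupOr f n ys n≤l)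

∈⇒∷ : ∀ {A : Set} {x : A} {xs} → x ∈ xs → ∃ λ y → ∃ λ ys → xs ≡ y ∷ ys
∈⇒∷ {xs = y ∷ ys} _ = y , ys , refl

sumList-map : ∀ {A B : Set} (f : B → ℕ) (g : A → B) xs → sumList f (map g xs) ≡ sumList (f ∘ g) xs
sumList-map f g []       = refl
sumList-map f g (x ∷ xs) = cong (f (g x) +_) (sumList-map f g xs)

sumList-tabulate : ∀ {A : Set} n (f : A → ℕ) (g : Fin n → A) → sumList f (tabulate g) ≡ sumFin n (f ∘ g)
sumList-tabulate zero    f g = refl
sumList-tabulate (suc n) f g = cong (f (g zero) +_) (sumList-tabulate n f (g ∘ suc))

sumList-cartesianProductWith : ∀ {A B C : Set} (f : C → ℕ) (_·_ : A → B → C) xs ys →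
  sumList f (cartesianProductWith _·_ xs ys) ≡ sumList (λ a → sumList (λ b → f (a · b)) ys) xs
sumList-cartesianProductWith f _·_ []       ys = refl
sumList-cartesianProductWith f _·_ (x ∷ xs) ys = trans (sumList-++ f (map (x ·_) ys) _)
  (cong₂ _+_ (sumList-map f (x ·_) ys) (sumList-cartesianProductWith f _·_ xs ys))

sumFin-cong : ∀ n {f g : Fin n → ℕ} → (∀ a → f a ≡ g a) → sumFin n f ≡ sumFin n g
sumFin-cong zero    f≗g = refl
sumFin-cong (suc n) f≗g = cong₂ _+_ (f≗g zero) (sumFin-cong n (f≗g ∘ suc))

sumFin-mono : ∀ n {f g : Fin n → ℕ} → (∀ a → f a ≤ g a) → sumFin n f ≤ sumFin n g
sumFin-mono zero    f≤g = z≤n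
sumFin-mono (suc n) f≤g = +-mono-≤ (f≤g zero) (sumFin-mono n (f≤g ∘ suc))

sumFin-mono-< : ∀ n {f g : Fin n → ℕ} (a : Fin n) → (∀ b → f b ≤ g b) → f a < g a → sumFin n f < sumFin n g
sumFin-mono-< (suc n) zero    f≤g lt = +-mono-<-≤ lt (sumFin-mono n (f≤g ∘ suc))
sumFin-mono-< (suc n) (suc a) f≤g lt = +-mono-≤-< (f≤g zero) (sumFin-mono-< n a (f≤g ∘ suc) lt)

sumFin-+ : ∀ n (f g : Fin n → ℕ) → sumFin n (λ a → f a + g a) ≡ sumFin n f + sumFin n g
sumFin-+ zero    f g = refl
sumFin-+ (suc n) f g rewrite sumFin-+ n (f ∘ suc) (g ∘ suc) =
  solve 4 (λ a b c d → (a :+ b) :+ (c :+ d) := (a :+ c) :+ (b :+ d)) refl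
    (f zero) (g zero) (sumFin n (f ∘ suc)) (sumFin n (g ∘ suc))

sumFin-const : ∀ n c → sumFin n (λ _ → c) ≡ n * c
sumFin-const zero    c = refl
sumFin-const (suc n) c = cong (c +_) (sumFin-const n c)

sumFin-init-last : ∀ n (f : Fin (suc n) → ℕ) → sumFin (suc n) f ≡ sumFin n (f ∘ inject₁) + f (fromℕ n)
sumFin-init-last zero    f = +-identityʳ (f zero)
sumFin-init-last (suc n) f rewrite sumFin-init-last n (f ∘ suc) = sym (+-assoc (f zero) _ _)

sumFin-opposite : ∀ n (f : Fin n → ℕ) → sumFin n (f ∘ opposite) ≡ sumFin n f
sumFin-opposite zero    f = refl
sumFin-opposite (suc n) f = begin
    f (fromℕ n) + sumFin n (f ∘ opposite ∘ suc)
  ≡⟨ cong (f (fromℕ n) +_) (sumFin-opposite n (f ∘ inject₁)) ⟩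
    f (fromℕ n) + sumFin n (f ∘ inject₁)
  ≡⟨ +-comm (f (fromℕ n)) _ ⟩
    sumFin n (f ∘ inject₁) + f (fromℕ n)
  ≡⟨ sumFin-init-last n f ⟨
    sumFin (suc n) f ∎
  where open ≡-Reasoning

sumTo-cong : ∀ b {f g : ℕ → ℕ} → (∀ x → x ≤ b → f x ≡ g x) → sumTo b f ≡ sumTo b g
sumTo-cong zero    f≗g = f≗g 0 z≤n
sumTo-cong (suc b) f≗g = cong₂ _+_ (sumTo-cong b (λ x x≤b → f≗g x (m≤n⇒m≤1+n x≤b))) (f≗g (suc b) ≤-refl)

sumTo-+ : ∀ b (f g : ℕ → ℕ) → sumTo b (λ x → f x + g x) ≡ sumTo b f + sumTo b g
sumTo-+ zero    f g = refl
sumTo-+ (suc b) f g rewrite sumTo-+ b f g =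
  solve 4 (λ a b c d → (a :+ b) :+ (c :+ d) := (a :+ c) :+ (b :+ d)) refl (sumTo b f) (sumTo b g) (f (suc b)) (g (suc b))

sumTo-*ˡ : ∀ b c (f : ℕ → ℕ) → sumTo b (λ x → c * f x) ≡ c * sumTo b f
sumTo-*ˡ zero    c f = refl
sumTo-*ˡ (suc b) c f rewrite sumTo-*ˡ b c f = sym (*-distribˡ-+ c _ (f (suc b)))

sumTo-suc : ∀ b (f : ℕ → ℕ) → sumTo (suc b) f ≡ f 0 + sumTo b (f ∘ suc)
sumTo-suc zero    f = refl
sumTo-suc (suc b) f rewrite sumTo-suc b f = +-assoc (f 0) _ _

sumTo-vanishing : ∀ {b c} (f : ℕ → ℕ) → b ≤ c → (∀ x → b < x → f x ≡ 0) → sumTo c f ≡ sumTo b f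
sumTo-vanishing {b} {c} f b≤c f≡0 = trans (cong (λ z → sumTo z f) (sym (m∸n+n≡m b≤c))) (beyond (c ∸ b))
  where
  beyond : ∀ d → sumTo (d + b) f ≡ sumTo b f
  beyond zero    = refl
  beyond (suc d) rewrite beyond d | f≡0 (suc (d + b)) (s≤s (m≤n+m b d)) = +-identityʳ _

-- Words and their weights

mismatch : ∀ {d} → Fin d → Fin d → ℕ
mismatch i a = 𝟙 (¬? (a ≟ i))

sumFin-mismatch : ∀ K (i : Fin (suc K)) (G : ℕ → ℕ) → sumFin (suc K) (λ a → G (mismatch i a)) ≡ G 0 + K * G 1
sumFin-mismatch K       zero    G = cong (G 0 +_) (sumFin-const K (G 1))
sumFin-mismatch (suc K) (suc i) G rewrite sumFin-mismatch K i G =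
  solve 3 (λ a b c → b :+ (a :+ c :* b) := a :+ (b :+ c :* b)) refl (G 0) (G 1) K

weightCount : ℕ → ℕ → ℕ → ℕ
weightCount K L x = (L C x) * K ^ x

weightCount-pascal : ∀ K L x → weightCount K (suc L) (suc x) ≡ K * weightCount K L x + weightCount K L (suc x)
weightCount-pascal K L x = begin
    (suc L C suc x) * (K * K ^ x)
  ≡⟨ cong (_* (K * K ^ x)) (nCk+nC[k+1]≡[n+1]C[k+1] L x) ⟨
    (L C x + L C suc x) * (K * K ^ x)
  ≡⟨ solve 4 (λ a b c d → (a :+ b) :* (c :* d) := c :* (a :* d) :+ b :* (c :* d)) refl (L C x) (L C suc x) K (K ^ x) ⟩
    K * weightCount K L x + weightCount K L (suc x) ∎
  where open ≡-Reasoning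

sumTo-weightCount-suc : ∀ K L (F : ℕ → ℕ) →
  sumTo (suc L) (λ x → weightCount K (suc L) x * F x)
  ≡ sumTo L (λ x → weightCount K L x * F x) + K * sumTo L (λ x → weightCount K L x * F (suc x))
sumTo-weightCount-suc K L F = begin
    sumTo (suc L) (λ x → weightCount K (suc L) x * F x)
  ≡⟨ sumTo-suc L _ ⟩
    F₀ + sumTo L (λ x → weightCount K (suc L) (suc x) * F (suc x))
  ≡⟨ cong (F₀ +_) (sumTo-cong L (λ x _ → cong (_* F (suc x)) (weightCount-pascal K L x))) ⟩
    F₀ + sumTo L (λ x → (K * weightCount K L x + weightCount K L (suc x)) * F (suc x))
  ≡⟨ cong (F₀ +_) (sumTo-cong L (λ x _ → *-distribʳ-+ (F (suc x)) (K * weightCount K L x) _)) ⟩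
    F₀ + sumTo L (λ x → K * weightCount K L x * F (suc x) + weightCount K L (suc x) * F (suc x))
  ≡⟨ cong (F₀ +_) (sumTo-+ L _ _) ⟩
    F₀ + (sumTo L (λ x → K * weightCount K L x * F (suc x)) + down)
  ≡⟨ cong (λ z → F₀ + (z + down)) (trans (sumTo-cong L (λ x _ → *-assoc K _ _)) (sumTo-*ˡ L K _)) ⟩
    F₀ + (K * up + down)
  ≡⟨ solve 3 (λ a b c → a :+ (b :+ c) := (a :+ c) :+ b) refl F₀ (K * up) down ⟩
    F₀ + down + K * up
  ≡⟨ cong (_+ K * up) (sumTo-suc L _) ⟨
    sumTo (suc L) (λ x → weightCount K L x * F x) + K * up
  ≡⟨ cong (_+ K * up) (sumTo-vanishing _ (n≤1+n L) λ x L<x → cong (_* F x) (cong (_* K ^ x) (k>n⇒nCk≡0 L<x))) ⟩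
    sumTo L (λ x → weightCount K L x * F x) + K * up ∎
  where
  open ≡-Reasoning
  F₀ up down : ℕ
  F₀   = weightCount K L 0 * F 0
  up   = sumTo L (λ x → weightCount K L x * F (suc x))
  down = sumTo L (λ x → weightCount K L (suc x) * F (suc x))

module Words (K : ℕ) (i : Fin (suc K)) where

  Word : ℕ → Set
  Word = Vec (Fin (suc K))

  weight : ∀ {L} → Word L → ℕ
  weight {L} w = sumFin L (mismatch i ∘ lookup w)

  allWords : ∀ L → List (Word L)
  allWords zero    = [] ∷ []
  allWords (suc L) = cartesianProductWith _∷_ (allFin (suc K)) (allWords L)

  ∈-allWords : ∀ {L} (w : Word L) → w ∈ allWords L
  ∈-allWords []      = here refl
  ∈-allWords (a ∷ w) = ∈-cartesianProductWith⁺ _∷_ (∈-allFin a) (∈-allWords w)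

  allWords-unique : ∀ L → Unique (allWords L)
  allWords-unique zero    = All.[] ∷ []
  allWords-unique (suc L) = cartesianProductWith⁺ _∷_ ∷-injective (allFin⁺ (suc K)) (allWords-unique L)

  sumList-allWords-suc : ∀ L (g : Word (suc L) → ℕ) →
    sumList g (allWords (suc L)) ≡ sumFin (suc K) (λ a → sumList (g ∘ (a ∷_)) (allWords L))
  sumList-allWords-suc L g = trans (sumList-cartesianProductWith g _∷_ (allFin (suc K)) (allWords L))
                                   (sumList-tabulate (suc K) _ id)

  allWords-size : ∀ L → sumList (λ _ → 1) (allWords L) ≡ suc K ^ L
  allWords-size zero    = refl
  allWords-size (suc L) = begin
      sumList (λ _ → 1) (allWords (suc L))
    ≡⟨ sumList-allWords-suc L _ ⟩
      sumFin (suc K) (λ _ → sumList (λ _ → 1) (allWords L))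
    ≡⟨ cong (sumFin (suc K) ∘ λ z _ → z) (allWords-size L) ⟩
      sumFin (suc K) (λ _ → suc K ^ L)
    ≡⟨ sumFin-const (suc K) _ ⟩
      suc K ^ suc L ∎
    where open ≡-Reasoning

  sumList-allWords-weight : ∀ L (F : ℕ → ℕ) →
    sumList (F ∘ weight) (allWords L) ≡ sumTo L (λ x → weightCount K L x * F x)
  sumList-allWords-weight zero    F = refl
  sumList-allWords-weight (suc L) F = begin
      sumList (F ∘ weight) (allWords (suc L))
    ≡⟨ sumList-allWords-suc L _ ⟩
      sumFin (suc K) (λ a → G (mismatch i a))
    ≡⟨ sumFin-mismatch K i G ⟩
      G 0 + K * G 1
    ≡⟨ cong₂ (λ u v → u + K * v) (sumList-allWords-weight L F) (sumList-allWords-weight L (F ∘ suc)) ⟩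
      sumTo L (λ x → weightCount K L x * F x) + K * sumTo L (λ x → weightCount K L x * F (suc x))
    ≡⟨ sumTo-weightCount-suc K L F ⟨
      sumTo (suc L) (λ x → weightCount K (suc L) x * F x) ∎
    where
    open ≡-Reasoning
    G : ℕ → ℕ
    G y = sumList (λ w → F (y + weight w)) (allWords L)

  sumList-allWords-deficit : ∀ {L} J → J ≤ L →
    sumList (λ v → J ∸ weight v) (allWords L) ≡ sumTo J (λ x → weightCount K L x * (J ∸ x))
  sumList-allWords-deficit {L} J J≤L = trans (sumList-allWords-weight L (J ∸_))
    (sumTo-vanishing _ J≤L (λ x J<x → trans (cong (weightCount K L x *_) (m≤n⇒m∸n≡0 (<⇒≤ J<x))) (*-zeroʳ (weightCount K L x))))

  weight≤length : ∀ {L} (v : Word L) → weight v ≤ L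
  weight≤length {L} v = begin
      sumFin L (mismatch i ∘ lookup v) ≤⟨ sumFin-mono L (λ t → 𝟙≤1 (¬? (lookup v t ≟ i))) ⟩
      sumFin L (λ _ → 1)               ≡⟨ sumFin-const L 1 ⟩
      L * 1                            ≡⟨ *-identityʳ L ⟩
      L                                ∎
    where open ≤-Reasoning

  reverseWord : ∀ {L} → Word L → Word L
  reverseWord v = Vec.tabulate (lookup v ∘ opposite)

  reverseWord-involutive : ∀ {L} (v : Word L) → reverseWord (reverseWord v) ≡ v
  reverseWord-involutive v = trans
    (tabulate-cong (λ t → trans (lookup∘tabulate _ (opposite t)) (cong (lookup v) (opposite-involutive t))))
    (tabulate∘lookup v)

  weight-reverseWord : ∀ {L} (v : Word L) → weight (reverseWord v) ≡ weight v
  weight-reverseWord {L} v = trans (sumFin-cong L (λ t → cong (mismatch i) (lookup∘tabulate _ t)))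
                                   (sumFin-opposite L (mismatch i ∘ lookup v))


-- Automorphisms of the book graph

transpose-matchˡ : ∀ {n} (p q : Fin n) → PC.transpose p q p ≡ q
transpose-matchˡ p q rewrite dec-true (p ≟ p) refl = refl

transpose-respects : ∀ {n} {A : Set} (h : Fin n → A) {p q} → h p ≡ h q → ∀ r → h (PC.transpose p q r) ≡ h r
transpose-respects h {p} {q} hp≡hq r with r ≟ p
... | yes refl = sym hp≡hq
... | no _ with r ≟ q
...   | yes refl = hp≡hq
...   | no _     = refl

module _ {n m : ℕ} where

  private
    L : ℕ
    L = m ∸ 2

  edge⇒adj-preserved : (f : Vtx n m → Vtx n m) → (∀ x y → Edge x y → Adj (f x) (f y)) →
                       ∀ x y → Adj x y → Adj (f x) (f y)
  edge⇒adj-preserved f f-edge x y (inj₁ e) = f-edge x y e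
  edge⇒adj-preserved f f-edge x y (inj₂ e) with f-edge y x e
  ... | inj₁ e′ = inj₂ e′
  ... | inj₂ e′ = inj₁ e′

  mkAut : (f g : Vtx n m → Vtx n m) → (∀ x → f (g x) ≡ x) → (∀ x → g (f x) ≡ x) →
          (∀ x y → Edge x y → Adj (f x) (f y)) → (∀ x y → Edge x y → Adj (g x) (g y)) → Aut n m
  mkAut f g fg≗id gf≗id f-edge g-edge = record
    { perm    = mk↔ₛ′ f g fg≗id gf≗id
    ; pres    = edge⇒adj-preserved f f-edge
    ; reflect = λ x y fx~fy → subst₂ Adj (gf≗id x) (gf≗id y) (edge⇒adj-preserved g g-edge (f x) (f y) fx~fy)
    }

  app-injective : (σ : Aut n m) {x y : Vtx n m} → app σ x ≡ app σ y → x ≡ y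
  app-injective σ = Injection.injective (↔⇒↣ (Aut.perm σ))

  page-injectiveˡ : ∀ {p q : Fin n} {t t′ : Fin L} → page {n} {m} p t ≡ page q t′ → p ≡ q
  page-injectiveˡ refl = refl

  mapPages : (Fin n → Fin n) → Vtx n m → Vtx n m
  mapPages g (spine b)  = spine b
  mapPages g (page r t) = page (g r) t

  mapPages-edge : ∀ g x y → Edge x y → Adj (mapPages g x) (mapPages g y)
  mapPages-edge g _ _ ss           = inj₁ ss
  mapPages-edge g _ _ (sp i p e)   = inj₁ (sp (g i) p e)
  mapPages-edge g _ _ (pp i p q e) = inj₁ (pp (g i) p q e)
  mapPages-edge g _ _ (ps i p e)   = inj₁ (ps (g i) p e)

  mapPages-inverse : ∀ {f g} → (∀ r → g (f r) ≡ r) → ∀ x → mapPages g (mapPages f x) ≡ x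
  mapPages-inverse gf≗id (spine b)  = refl
  mapPages-inverse gf≗id (page r t) = cong (λ r → page r t) (gf≗id r)

  permutePages : Permutation′ n → Aut n m
  permutePages π = mkAut (mapPages (π ⟨$⟩ʳ_)) (mapPages (π ⟨$⟩ˡ_))
    (mapPages-inverse (λ _ → inverseʳ π)) (mapPages-inverse (λ _ → inverseˡ π))
    (mapPages-edge _) (mapPages-edge _)

  reflectPagesMap : (Fin n → Fin n) → Vtx n m → Vtx n m
  reflectPagesMap g (spine zero)       = spine (suc zero)
  reflectPagesMap g (spine (suc zero)) = spine zero
  reflectPagesMap g (page r t)         = page (g r) (opposite t)

  reflectPagesMap-edge : ∀ g x y → Edge x y → Adj (reflectPagesMap g x) (reflectPagesMap g y)
  reflectPagesMap-edge g _ _ ss = inj₂ ss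
  reflectPagesMap-edge g _ _ (sp i p p≡0) = inj₂ (ps (g i) (opposite p) (begin
      suc (toℕ (opposite p)) ≡⟨ cong suc (opposite-prop p) ⟩
      suc (L ∸ suc (toℕ p))  ≡⟨ +-∸-assoc 1 (toℕ<n p) ⟨
      L ∸ toℕ p              ≡⟨ cong (L ∸_) p≡0 ⟩
      L                      ∎))
    where open ≡-Reasoning
  reflectPagesMap-edge g _ _ (pp i p q q≡1+p) = inj₂ (pp (g i) (opposite q) (opposite p) (begin
      toℕ (opposite p)       ≡⟨ opposite-prop p ⟩
      L ∸ suc (toℕ p)        ≡⟨ cong (L ∸_) q≡1+p ⟨
      L ∸ toℕ q              ≡⟨ +-∸-assoc 1 (toℕ<n q) ⟩
      suc (L ∸ suc (toℕ q))  ≡⟨ cong suc (opposite-prop q) ⟨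
      suc (toℕ (opposite q)) ∎))
    where open ≡-Reasoning
  reflectPagesMap-edge g _ _ (ps i p 1+p≡L) = inj₂ (sp (g i) (opposite p) (begin
      toℕ (opposite p) ≡⟨ opposite-prop p ⟩
      L ∸ suc (toℕ p)  ≡⟨ cong (L ∸_) 1+p≡L ⟩
      L ∸ L            ≡⟨ n∸n≡0 L ⟩
      0                ∎))
    where open ≡-Reasoning

  reflectPagesMap-inverse : ∀ {f g} → (∀ r → g (f r) ≡ r) → ∀ x → reflectPagesMap g (reflectPagesMap f x) ≡ x
  reflectPagesMap-inverse gf≗id (spine zero)       = refl
  reflectPagesMap-inverse gf≗id (spine (suc zero)) = refl
  reflectPagesMap-inverse gf≗id (page r t)         = cong₂ page (gf≗id r) (opposite-involutive t)

  reflectPages : Permutation′ n → Aut n m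
  reflectPages π = mkAut (reflectPagesMap (π ⟨$⟩ʳ_)) (reflectPagesMap (π ⟨$⟩ˡ_))
    (reflectPagesMap-inverse (λ _ → inverseʳ π)) (reflectPagesMap-inverse (λ _ → inverseˡ π))
    (reflectPagesMap-edge _) (reflectPagesMap-edge _)

  pageWord : ∀ {d} → Coloring n m d → Fin n → Vec (Fin d) L
  pageWord c p = Vec.tabulate (λ t → c (page p t))

  lookup-pageWord : ∀ {d} (c : Coloring n m d) p t → lookup (pageWord c p) t ≡ c (page p t)
  lookup-pageWord c p t = lookup∘tabulate _ t

  distinguishing⇒pageWord-injective : ∀ {d} {c : Coloring n m d} → IsDistinguishing c → Fin L →
                                      ∀ {p q} → pageWord c p ≡ pageWord c q → p ≡ q
  distinguishing⇒pageWord-injective {c = c} dist t₀ {p} {q} eq =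
    sym (page-injectiveˡ (trans (cong (λ r → page r t₀) (sym (transpose-matchˡ p q)))
                                (dist (permutePages (transpose p q)) colours-kept (page p t₀))))
    where
    same-colour : ∀ t → c (page p t) ≡ c (page q t)
    same-colour t = trans (sym (lookup-pageWord c p t)) (trans (cong (λ w → lookup w t) eq) (lookup-pageWord c q t))
    colours-kept : ∀ v → c (app (permutePages (transpose p q)) v) ≡ c v
    colours-kept (spine b)  = refl
    colours-kept (page r t) = transpose-respects (λ r → c (page r t)) (same-colour t) r

  Below : Fin n → Fin L → Vtx n m → Set
  Below i t y = (y ≡ spine zero × toℕ t ≡ 0) ⊎ ∃ λ p → y ≡ page i p × suc (toℕ p) ≡ toℕ t

  Above : Fin n → Fin L → Vtx n m → Set
  Above i t y = (∃ λ q → y ≡ page i q × toℕ q ≡ suc (toℕ t)) ⊎ (y ≡ spine (suc zero) × suc (toℕ t) ≡ L)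

  page-neighbour : ∀ {i t y} → Adj (page i t) y → Below i t y ⊎ Above i t y
  page-neighbour (inj₁ (pp _ _ q e)) = inj₂ (inj₁ (q , refl , e))
  page-neighbour (inj₁ (ps _ _ e))   = inj₂ (inj₂ (refl , e))
  page-neighbour (inj₂ (sp _ _ e))   = inj₁ (inj₁ (refl , e))
  page-neighbour (inj₂ (pp _ p _ e)) = inj₁ (inj₂ (p , refl , sym e))

  Below-unique : ∀ {i t y y′} → Below i t y → Below i t y′ → y ≡ y′
  Below-unique (inj₁ (refl , _))       (inj₁ (refl , _))         = refl
  Below-unique (inj₁ (_ , t≡0))        (inj₂ (_ , _ , 1+p≡t))    = ⊥-elim (1+n≢0 (trans 1+p≡t t≡0))
  Below-unique (inj₂ (_ , _ , 1+p≡t))  (inj₁ (_ , t≡0))          = ⊥-elim (1+n≢0 (trans 1+p≡t t≡0))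
  Below-unique (inj₂ (p , refl , 1+p≡t)) (inj₂ (p′ , refl , 1+p′≡t)) =
    cong (page _) (toℕ-injective (suc-injective (trans 1+p≡t (sym 1+p′≡t))))

  Above-unique : ∀ {i t y y′} → Above i t y → Above i t y′ → y ≡ y′
  Above-unique (inj₂ (refl , _))         (inj₂ (refl , _))         = refl
  Above-unique (inj₁ (q , _ , q≡1+t))    (inj₂ (_ , 1+t≡L))        = ⊥-elim (<-irrefl (trans q≡1+t 1+t≡L) (toℕ<n q))
  Above-unique (inj₂ (_ , 1+t≡L))        (inj₁ (q , _ , q≡1+t))    = ⊥-elim (<-irrefl (trans q≡1+t 1+t≡L) (toℕ<n q))
  Above-unique (inj₁ (q , refl , q≡1+t)) (inj₁ (q′ , refl , q′≡1+t)) = cong (page _) (toℕ-injective (trans q≡1+t (sym q′≡1+t)))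

  Below-page⇒< : ∀ {i t i′ q} → Below i t (page i′ q) → toℕ q < toℕ t
  Below-page⇒< (inj₂ (_ , refl , 1+q≡t)) = ≤-reflexive 1+q≡t

  page-neighbours-collide : ∀ {i t y₁ y₂ y₃} → Adj (page i t) y₁ → Adj (page i t) y₂ → Adj (page i t) y₃ →
                            y₁ ≡ y₂ ⊎ y₁ ≡ y₃ ⊎ y₂ ≡ y₃
  page-neighbours-collide a₁ a₂ a₃ with page-neighbour a₁ | page-neighbour a₂ | page-neighbour a₃
  ... | inj₁ b₁ | inj₁ b₂ | _       = inj₁ (Below-unique b₁ b₂)
  ... | inj₂ u₁ | inj₂ u₂ | _       = inj₁ (Above-unique u₁ u₂)
  ... | inj₁ b₁ | inj₂ _  | inj₁ b₃ = inj₂ (inj₁ (Below-unique b₁ b₃))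
  ... | inj₂ u₁ | inj₁ _  | inj₂ u₃ = inj₂ (inj₁ (Above-unique u₁ u₃))
  ... | inj₁ _  | inj₂ u₂ | inj₂ u₃ = inj₂ (inj₂ (Above-unique u₂ u₃))
  ... | inj₂ _  | inj₁ b₂ | inj₁ b₃ = inj₂ (inj₂ (Below-unique b₂ b₃))

  record ThreeNeighbours (v : Vtx n m) : Set where
    field
      {y₁ y₂ y₃} : Vtx n m
      adj₁  : Adj v y₁
      adj₂  : Adj v y₂
      adj₃  : Adj v y₃
      y₁≢y₂ : y₁ ≢ y₂
      y₁≢y₃ : y₁ ≢ y₃
      y₂≢y₃ : y₂ ≢ y₃

  ThreeNeighbours⇒spine : ∀ {v} → ThreeNeighbours v → ∃ λ b → v ≡ spine b
  ThreeNeighbours⇒spine {spine b}  _  = b , refl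
  ThreeNeighbours⇒spine {page i t} nb with page-neighbours-collide adj₁ adj₂ adj₃
    where open ThreeNeighbours nb
  ... | inj₁ y₁≡y₂        = ⊥-elim (ThreeNeighbours.y₁≢y₂ nb y₁≡y₂)
  ... | inj₂ (inj₁ y₁≡y₃) = ⊥-elim (ThreeNeighbours.y₁≢y₃ nb y₁≡y₃)
  ... | inj₂ (inj₂ y₂≡y₃) = ⊥-elim (ThreeNeighbours.y₂≢y₃ nb y₂≡y₃)

  aut-ThreeNeighbours : (σ : Aut n m) → ∀ {v} → ThreeNeighbours v → ThreeNeighbours (app σ v)
  aut-ThreeNeighbours σ {v} nb = record
    { adj₁  = Aut.pres σ _ _ adj₁
    ; adj₂  = Aut.pres σ _ _ adj₂
    ; adj₃  = Aut.pres σ _ _ adj₃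
    ; y₁≢y₂ = y₁≢y₂ ∘ app-injective σ
    ; y₁≢y₃ = y₁≢y₃ ∘ app-injective σ
    ; y₂≢y₃ = y₂≢y₃ ∘ app-injective σ
    }
    where open ThreeNeighbours nb

module _ {n′ L′ : ℕ} where

  private
    n m : ℕ
    n = suc (suc n′)
    m = suc (suc (suc L′))

  spine-ThreeNeighbours : ∀ b → ThreeNeighbours (spine {n} {m} b)
  spine-ThreeNeighbours zero = record
    { adj₁ = inj₁ ss ; adj₂ = inj₁ (sp zero zero refl) ; adj₃ = inj₁ (sp (suc zero) zero refl)
    ; y₁≢y₂ = λ () ; y₁≢y₃ = λ () ; y₂≢y₃ = λ () }
  spine-ThreeNeighbours (suc zero) = record
    { adj₁ = inj₂ ss ; adj₂ = inj₂ (ps zero last last-ends) ; adj₃ = inj₂ (ps (suc zero) last last-ends)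
    ; y₁≢y₂ = λ () ; y₁≢y₃ = λ () ; y₂≢y₃ = λ () }
    where
    last = fromℕ L′
    last-ends = cong suc (toℕ-fromℕ L′)

  below : Fin n → Fin (suc L′) → Vtx n m
  below i zero    = spine zero
  below i (suc t) = page i (inject₁ t)

  Below-below : ∀ i t → Below i t (below i t)
  Below-below i zero    = inj₁ (refl , refl)
  Below-below i (suc t) = inj₂ (inject₁ t , refl , cong suc (toℕ-inject₁ t))

  module ColourPreservingAut {d} (c : Coloring n m d) (spines≢ : c (spine zero) ≢ c (spine (suc zero)))
                             (σ : Aut n m) (kept : ∀ v → c (app σ v) ≡ c v) where

    spine-fixed : ∀ b → app σ (spine b) ≡ spine b
    spine-fixed b with ThreeNeighbours⇒spine (aut-ThreeNeighbours σ (spine-ThreeNeighbours b))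
    spine-fixed zero       | zero , e     = e
    spine-fixed zero       | suc zero , e = ⊥-elim (spines≢ (trans (sym (kept _)) (cong c e)))
    spine-fixed (suc zero) | zero , e     = ⊥-elim (spines≢ (trans (sym (cong c e)) (kept _)))
    spine-fixed (suc zero) | suc zero , e = e

    page-image : ∀ i t → ∃ λ j → ∃ λ t′ → app σ (page i t) ≡ page j t′
    page-image i t with app σ (page i t) in eq
    ... | page j t′ = j , t′ , refl
    ... | spine b with () ← app-injective σ (trans eq (sym (spine-fixed b)))

    pageImage : Fin n → Fin n
    pageImage i = proj₁ (page-image i zero)

    -- Induction along page i: the lower neighbour of position t goes to the lower neighbour in
    -- page (pageImage i), so the upper neighbour must go to the upper neighbour.
    Tracked : Fin n → Fin (suc L′) → Set
    Tracked i t = app σ (page i t) ≡ page (pageImage i) t × app σ (below i t) ≡ below (pageImage i) t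

    tracked-zero : ∀ i → Tracked i zero
    tracked-zero i with page-image i zero
    ... | j , t′ , e = trans e (cong (page j) (toℕ-injective (first-position (subst₂ Adj (spine-fixed zero) e
                         (Aut.pres σ _ _ (inj₁ (sp i zero refl))))))) , spine-fixed zero
      where
      first-position : ∀ {j t′} → Adj (spine zero) (page {n} {m} j t′) → toℕ t′ ≡ 0
      first-position (inj₁ (sp _ _ e)) = e

    tracked-suc : ∀ i t → Tracked i (inject₁ t) → Tracked i (suc t)
    tracked-suc i t (σt , σbelow) with page-image i (suc t)
    ... | j′ , t′ , e with page-neighbour (subst₂ Adj σt e (Aut.pres σ _ _ (inj₁ (pp i (inject₁ t) (suc t) t+1))))
      where t+1 = cong suc (sym (toℕ-inject₁ t))
    ... | inj₂ (inj₁ (q , refl , q≡t+1)) = trans e (cong (page _) (toℕ-injective (trans q≡t+1 (cong suc (toℕ-inject₁ t))))) , σt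
    ... | inj₂ (inj₂ (σx≡spine , _)) with () ← app-injective σ (trans (trans e σx≡spine) (sym (spine-fixed (suc zero))))
    ... | inj₁ b = ⊥-elim (<⇒≱ (Below-page⇒< below-x) (m≤n⇒m≤1+n (≤-reflexive (toℕ-inject₁ t))))
      where
      below-x : Below i (inject₁ t) (page i (suc t))
      below-x = subst (Below i (inject₁ t)) (app-injective σ (trans (trans σbelow
                  (Below-unique (Below-below _ (inject₁ t)) b)) (sym e))) (Below-below i (inject₁ t))

    tracked : ∀ i t → Tracked i t
    tracked i = <-weakInduction (Tracked i) (tracked-zero i) (tracked-suc i)

    pageWord-pageImage : ∀ i → pageWord c (pageImage i) ≡ pageWord c i
    pageWord-pageImage i = tabulate-cong (λ t → trans (cong c (sym (proj₁ (tracked i t)))) (kept (page i t)))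

  spines≢∧pageWord-injective⇒distinguishing : ∀ {d} (c : Coloring n m d) → c (spine zero) ≢ c (spine (suc zero)) →
    (∀ {p q} → pageWord c p ≡ pageWord c q → p ≡ q) → IsDistinguishing c
  spines≢∧pageWord-injective⇒distinguishing c spines≢ pageWord-inj σ kept (spine b)  = spine-fixed b
    where open ColourPreservingAut c spines≢ σ kept
  spines≢∧pageWord-injective⇒distinguishing c spines≢ pageWord-inj σ kept (page i t) =
    trans (proj₁ (tracked i t)) (cong (λ r → page r t) (pageWord-inj (pageWord-pageImage i)))
    where open ColourPreservingAut c spines≢ σ kept

spineMismatch : ∀ {n m d} → Coloring n m d → Fin d → ℕ
spineMismatch c i = mismatch i (c (spine zero)) + mismatch i (c (spine (suc zero)))

spineMismatch-positive : ∀ {n m d} (c : Coloring n m d) i →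
  (c (spine zero) ≡ i × c (spine (suc zero)) ≡ i) ⊎ 1 ≤ spineMismatch c i
spineMismatch-positive c i with c (spine zero) ≟ i | c (spine (suc zero)) ≟ i
... | yes s₀ | yes s₁ = inj₁ (s₀ , s₁)
... | no _   | _      = inj₂ (s≤s z≤n)
... | yes _  | no _   = inj₂ (s≤s z≤n)

outsideClass-decomposition : ∀ {n m K} (c : Coloring n m (suc K)) i →
  outsideClass c i ≡ spineMismatch c i + sumFin n (λ p → Words.weight K i (pageWord c p))
outsideClass-decomposition {n} {m} {K} c i = begin
    outsideClass c i
  ≡⟨ length-filter (λ v → ¬? (c v ≟ i)) (allVtx n m) ⟩
    sumList μ (allVtx n m)
  ≡⟨ sumList-++ μ (map spine (allFin 2)) (concatMap pageVertices (allFin n)) ⟩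
    mismatch i (c (spine zero)) + (mismatch i (c (spine (suc zero))) + 0) + sumList μ (concatMap pageVertices (allFin n))
  ≡⟨ cong₂ _+_ (cong (mismatch i (c (spine zero)) +_) (+-identityʳ _)) pages ⟩
    spineMismatch c i + sumFin n (λ p → Words.weight K i (pageWord c p)) ∎
  where
  open ≡-Reasoning
  μ : Vtx n m → ℕ
  μ = mismatch i ∘ c
  pageVertices : Fin n → List (Vtx n m)
  pageVertices p = map (page p) (allFin (m ∸ 2))
  pages : sumList μ (concatMap pageVertices (allFin n)) ≡ sumFin n (λ p → Words.weight K i (pageWord c p))
  pages = begin
      sumList μ (concat (map pageVertices (allFin n)))
    ≡⟨ sumList-concat μ (map pageVertices (allFin n)) ⟩
      sumList (sumList μ) (map pageVertices (allFin n))
    ≡⟨ sumList-map (sumList μ) pageVertices (allFin n) ⟩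
      sumList (sumList μ ∘ pageVertices) (allFin n)
    ≡⟨ sumList-tabulate n _ id ⟩
      sumFin n (sumList μ ∘ pageVertices)
    ≡⟨ sumFin-cong n (λ p → trans (sumList-map μ (page p) (allFin (m ∸ 2))) (sumList-tabulate (m ∸ 2) _ id)) ⟩
      sumFin n (λ p → sumFin (m ∸ 2) (λ t → μ (page p t)))
    ≡⟨ sumFin-cong n (λ p → sumFin-cong (m ∸ 2) (λ t → cong (mismatch i) (sym (lookup-pageWord c p t)))) ⟩
      sumFin n (λ p → Words.weight K i (pageWord c p)) ∎

-- Lower bound

add-bounds-cancel : ∀ {a b S A N} e₁ e₂ → a + e₁ ≤ S + A → b + A + e₂ ≤ N → a + b + (e₁ + e₂) ≤ S + N
add-bounds-cancel {a} {b} {S} {A} {N} e₁ e₂ h₁ h₂ = +-cancelʳ-≤ A _ _ (begin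
    a + b + (e₁ + e₂) + A    ≡⟨ solve 5 (λ a b e₁ e₂ A → a :+ b :+ (e₁ :+ e₂) :+ A := (a :+ e₁) :+ (b :+ A :+ e₂)) refl a b e₁ e₂ A ⟩
    (a + e₁) + (b + A + e₂)  ≤⟨ +-mono-≤ h₁ h₂ ⟩
    (S + A) + N              ≡⟨ solve 3 (λ S A N → (S :+ A) :+ N := (S :+ N) :+ A) refl S A N ⟩
    S + N + A                ∎)
  where open ≤-Reasoning

module LowerBound {n m K : ℕ} (c : Coloring n m (suc K)) (i : Fin (suc K)) (dist : IsDistinguishing c)
                  {j : ℕ} (j<L : j < m ∸ 2) (n≤nⱼ : n ≤ sumTo j (weightCount K (m ∸ 2))) where

  open Words K i

  L : ℕ
  L = m ∸ 2

  w : Fin n → Word L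
  w = pageWord c

  w-injective : ∀ {p q} → w p ≡ w q → p ≡ q
  w-injective = distinguishing⇒pageWord-injective dist (fromℕ< j<L)

  S nⱼ Nⱼ A : ℕ
  S  = ∑[ p < n ] weight (w p)
  nⱼ = ∑[ x ≤ j ] weightCount K L x
  Nⱼ = ∑[ x ≤ j ] (L ∸ x) * weightCount K L x
  A  = ∑[ x ≤ j ] weightCount K L x * (j ∸ x)

  pages≤allWords : ∀ (h : Word L → ℕ) → ∑[ p < n ] h (w p) ≤ sumList h (allWords L)
  pages≤allWords h = subst (_≤ sumList h (allWords L)) (sumList-tabulate n h w)
    (sumList-mono-⊆ h (allWords L) (tabulate⁺ w-injective) (λ _ → ∈-allWords _))

  pages+missing≤allWords : ∀ (h : Word L → ℕ) v → (∀ p → w p ≢ v) → h v + (∑[ p < n ] h (w p)) ≤ sumList h (allWords L)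
  pages+missing≤allWords h v v-missing = subst (_≤ sumList h (allWords L)) (cong (h v +_) (sumList-tabulate n h w))
    (sumList-mono-⊆ h (allWords L) (Allₚ.tabulate⁺ (λ p v≡wp → v-missing p (sym v≡wp)) ∷ tabulate⁺ w-injective)
      (λ _ → ∈-allWords _))

  deficit-bound : ∀ J → n * J ≤ S + (∑[ p < n ] (J ∸ weight (w p)))
  deficit-bound J = begin
      n * J                                               ≡⟨ sumFin-const n J ⟨
      ∑[ p < n ] J                                        ≤⟨ sumFin-mono n (λ p → m≤n+m∸n J (weight (w p))) ⟩
      ∑[ p < n ] (weight (w p) + (J ∸ weight (w p)))      ≡⟨ sumFin-+ n _ _ ⟩
      S + (∑[ p < n ] (J ∸ weight (w p)))                 ∎
    where open ≤-Reasoning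

  -- Distinct pages carry distinct words, so their deficits add up to at most those of all words.
  deficits≤A : ∑[ p < n ] (j ∸ weight (w p)) ≤ A
  deficits≤A = subst (∑[ p < n ] (j ∸ weight (w p)) ≤_) (sumList-allWords-deficit j (<⇒≤ j<L)) (pages≤allWords (λ v → j ∸ weight v))

  nj≤S+A : n * j ≤ S + A
  nj≤S+A = ≤-trans (deficit-bound j) (+-monoʳ-≤ S deficits≤A)

  heavy⇒nj<S+A : ∀ p → j < weight (w p) → n * j + 1 ≤ S + A
  heavy⇒nj<S+A p heavy = subst (_≤ S + A) (+-comm 1 (n * j)) (≤-trans strict (+-monoʳ-≤ S deficits≤A))
    where
    strict : n * j < S + (∑[ p < n ] (j ∸ weight (w p)))
    strict = begin-strict
        n * j                                           ≡⟨ sumFin-const n j ⟨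
        ∑[ p < n ] j                                    <⟨ sumFin-mono-< n p (λ q → m≤n+m∸n j (weight (w q)))
                                                             (<-≤-trans heavy (m≤m+n (weight (w p)) _)) ⟩
        ∑[ p < n ] (weight (w p) + (j ∸ weight (w p)))  ≡⟨ sumFin-+ n _ _ ⟩
        S + (∑[ p < n ] (j ∸ weight (w p)))             ∎
      where open ≤-Reasoning

  L-split : n * L ≡ n * j + n * (L ∸ j)
  L-split = trans (cong (n *_) (sym (m+[n∸m]≡n (<⇒≤ j<L)))) (*-distribˡ-+ n j (L ∸ j))

  nL+e≤S+Nⱼ : ∀ e₁ e₂ → n * j + e₁ ≤ S + A → n * (L ∸ j) + A + e₂ ≤ Nⱼ → n * L + (e₁ + e₂) ≤ S + Nⱼ
  nL+e≤S+Nⱼ e₁ e₂ h₁ h₂ = subst (λ z → z + (e₁ + e₂) ≤ S + Nⱼ) (sym L-split) (add-bounds-cancel e₁ e₂ h₁ h₂)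

  Nⱼ-split : Nⱼ ≡ (L ∸ j) * nⱼ + A
  Nⱼ-split = begin
      ∑[ x ≤ j ] (L ∸ x) * weightCount K L x
    ≡⟨ sumTo-cong j (λ x x≤j → trans (cong (_* weightCount K L x) (∸-split x≤j))
         (solve 3 (λ a b d → (a :+ b) :* d := a :* d :+ d :* b) refl (L ∸ j) (j ∸ x) (weightCount K L x))) ⟩
      ∑[ x ≤ j ] ((L ∸ j) * weightCount K L x + weightCount K L x * (j ∸ x))
    ≡⟨ sumTo-+ j _ _ ⟩
      (∑[ x ≤ j ] (L ∸ j) * weightCount K L x) + A
    ≡⟨ cong (_+ A) (sumTo-*ˡ j (L ∸ j) (weightCount K L)) ⟩
      (L ∸ j) * nⱼ + A ∎
    where
    open ≡-Reasoning
    ∸-split : ∀ {x} → x ≤ j → L ∸ x ≡ (L ∸ j) + (j ∸ x)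
    ∸-split {x} x≤j = begin
      L ∸ x             ≡⟨ cong (_∸ x) (m∸n+n≡m (<⇒≤ j<L)) ⟨
      (L ∸ j) + j ∸ x   ≡⟨ +-∸-assoc (L ∸ j) x≤j ⟩
      (L ∸ j) + (j ∸ x) ∎

  n[L∸j]+A+e≤Nⱼ : ∀ e → n + e ≤ nⱼ → n * (L ∸ j) + A + e ≤ Nⱼ
  n[L∸j]+A+e≤Nⱼ e n+e≤nⱼ = begin
      n * (L ∸ j) + A + e           ≡⟨ solve 3 (λ a b e → a :+ b :+ e := a :+ e :+ b) refl (n * (L ∸ j)) A e ⟩
      n * (L ∸ j) + e + A           ≤⟨ +-monoˡ-≤ A (+-monoʳ-≤ (n * (L ∸ j)) e≤e*[L∸j]) ⟩
      n * (L ∸ j) + e * (L ∸ j) + A ≡⟨ cong (_+ A) (*-distribʳ-+ (L ∸ j) n e) ⟨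
      (n + e) * (L ∸ j) + A         ≤⟨ +-monoˡ-≤ A (*-monoˡ-≤ (L ∸ j) n+e≤nⱼ) ⟩
      nⱼ * (L ∸ j) + A              ≡⟨ cong (_+ A) (*-comm nⱼ (L ∸ j)) ⟩
      (L ∸ j) * nⱼ + A              ≡⟨ Nⱼ-split ⟨
      Nⱼ                            ∎
    where
    open ≤-Reasoning
    e≤e*[L∸j] : e ≤ e * (L ∸ j)
    e≤e*[L∸j] = subst (_≤ e * (L ∸ j)) (*-identityʳ e) (*-monoʳ-≤ e (m<n⇒0<n∸m j<L))

  deficitSum-suc : ∑[ x ≤ suc j ] weightCount K L x * (suc j ∸ x) ≡ A + nⱼ
  deficitSum-suc = begin
      B + weightCount K L (suc j) * (j ∸ j)
    ≡⟨ cong (λ z → B + weightCount K L (suc j) * z) (n∸n≡0 j) ⟩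
      B + weightCount K L (suc j) * 0
    ≡⟨ trans (cong (B +_) (*-zeroʳ (weightCount K L (suc j)))) (+-identityʳ B) ⟩
      B
    ≡⟨ sumTo-cong j (λ x x≤j → trans (cong (weightCount K L x *_) (+-∸-assoc 1 x≤j))
         (solve 2 (λ a b → a :* (con 1 :+ b) := a :* b :+ a) refl (weightCount K L x) (j ∸ x))) ⟩
      ∑[ x ≤ j ] (weightCount K L x * (j ∸ x) + weightCount K L x)
    ≡⟨ sumTo-+ j _ _ ⟩
      A + nⱼ ∎
    where
    open ≡-Reasoning
    B : ℕ
    B = ∑[ x ≤ j ] weightCount K L x * (suc j ∸ x)

  missingReverse⇒nj<S+A : nⱼ ≡ n → (∀ p → weight (w p) ≤ j) → ∀ p₀ → (∀ q → w q ≢ reverseWord (w p₀)) → n * j + 1 ≤ S + A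
  missingReverse⇒nj<S+A nⱼ≡n light p₀ missing = +-cancelˡ-≤ n _ _ (begin
      n + (n * j + 1)                                  ≡⟨ solve 2 (λ n a → n :+ (a :+ con 1) := n :+ a :+ con 1) refl n (n * j) ⟩
      n + n * j + 1                                    ≡⟨ cong (_+ 1) (*-suc n j) ⟨
      n * suc j + 1                                    ≤⟨ +-mono-≤ (deficit-bound (suc j)) v₀-deficit ⟩
      S + (∑[ p < n ] h (w p)) + h v₀                  ≡⟨ solve 3 (λ S H h → S :+ H :+ h := S :+ (h :+ H)) refl S _ (h v₀) ⟩
      S + (h v₀ + (∑[ p < n ] h (w p)))                ≤⟨ +-monoʳ-≤ S (pages+missing≤allWords h v₀ missing) ⟩
      S + sumList h (allWords L)                       ≡⟨ cong (S +_) (trans (sumList-allWords-deficit (suc j) j<L) deficitSum-suc) ⟩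
      S + (A + nⱼ)                                     ≡⟨ cong (λ z → S + (A + z)) nⱼ≡n ⟩
      S + (A + n)                                      ≡⟨ solve 3 (λ S A n → S :+ (A :+ n) := n :+ (S :+ A)) refl S A n ⟩
      n + (S + A)                                      ∎)
    where
    open ≤-Reasoning
    h : Word L → ℕ
    h v = suc j ∸ weight v
    v₀ : Word L
    v₀ = reverseWord (w p₀)
    v₀-deficit : 1 ≤ h v₀
    v₀-deficit = m<n⇒0<n∸m (s≤s (subst (_≤ j) (sym (weight-reverseWord (w p₀))) (light p₀)))

  reversal-closed⇒⊥ : c (spine zero) ≡ i → c (spine (suc zero)) ≡ i → (∀ p → ∃ λ q → w q ≡ reverseWord (w p)) → ⊥
  reversal-closed⇒⊥ s₀ s₁ closed = spines≢ (dist (reflectPages (permutation ρ ρ ρ-involutive ρ-involutive)) kept (spine zero))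
    where
    spines≢ : spine {n} {m} (suc zero) ≢ spine zero
    spines≢ ()
    ρ : Fin n → Fin n
    ρ p = proj₁ (closed p)
    ρ-involutive : ∀ p → ρ (ρ p) ≡ p
    ρ-involutive p = w-injective (begin
      w (ρ (ρ p))                   ≡⟨ proj₂ (closed (ρ p)) ⟩
      reverseWord (w (ρ p))         ≡⟨ cong reverseWord (proj₂ (closed p)) ⟩
      reverseWord (reverseWord (w p)) ≡⟨ reverseWord-involutive (w p) ⟩
      w p                           ∎)
      where open ≡-Reasoning
    kept : ∀ v → c (reflectPagesMap ρ v) ≡ c v
    kept (spine zero)       = trans s₁ (sym s₀)
    kept (spine (suc zero)) = trans s₀ (sym s₁)
    kept (page r t) = begin
      c (page (ρ r) (opposite t))           ≡⟨ lookup-pageWord c (ρ r) (opposite t) ⟨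
      lookup (w (ρ r)) (opposite t)         ≡⟨ cong (λ v → lookup v (opposite t)) (proj₂ (closed r)) ⟩
      lookup (reverseWord (w r)) (opposite t) ≡⟨ lookup∘tabulate _ (opposite t) ⟩
      lookup (w r) (opposite (opposite t))  ≡⟨ cong (lookup (w r)) (opposite-involutive t) ⟩
      lookup (w r) t                        ≡⟨ lookup-pageWord c r t ⟩
      c (page r t)                          ∎
      where open ≡-Reasoning

  +0≤ : ∀ {a b} → a ≤ b → a + 0 ≤ b
  +0≤ = ≤-trans (≤-reflexive (+-identityʳ _))

  nL≤S+Nⱼ : n * L ≤ S + Nⱼ
  nL≤S+Nⱼ = ≤-trans (≤-reflexive (sym (+-identityʳ (n * L)))) (nL+e≤S+Nⱼ 0 0 (+0≤ nj≤S+A) (n[L∸j]+A+e≤Nⱼ 0 (+0≤ n≤nⱼ)))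

  -- With both spine vertices in the class one more unit is needed.
  nL<S+Nⱼ : c (spine zero) ≡ i → c (spine (suc zero)) ≡ i → n * L + 1 ≤ S + Nⱼ
  nL<S+Nⱼ s₀ s₁ with n <? nⱼ
  ... | yes n<nⱼ = nL+e≤S+Nⱼ 0 1 (+0≤ nj≤S+A) (n[L∸j]+A+e≤Nⱼ 1 (subst (_≤ nⱼ) (+-comm 1 n) n<nⱼ))
  ... | no n≮nⱼ with any? (λ p → j <? weight (w p))
  ...   | yes (p , heavy) = nL+e≤S+Nⱼ 1 0 (heavy⇒nj<S+A p heavy) (n[L∸j]+A+e≤Nⱼ 0 (+0≤ n≤nⱼ))
  ...   | no no-heavy with all? (λ p → any? (λ q → ≡-dec _≟_ (w q) (reverseWord (w p))))
  ...     | yes closed  = ⊥-elim (reversal-closed⇒⊥ s₀ s₁ closed)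
  ...     | no ¬closed with ¬∀⟶∃¬ n _ (λ p → any? (λ q → ≡-dec _≟_ (w q) (reverseWord (w p)))) ¬closed
  ...       | p₀ , missing = nL+e≤S+Nⱼ 1 0
                 (missingReverse⇒nj<S+A (≤-antisym (≮⇒≥ n≮nⱼ) n≤nⱼ) (λ p → ≮⇒≥ (λ heavy → no-heavy (p , heavy))) p₀ (λ q → missing ∘ (q ,_)))
                 (n[L∸j]+A+e≤Nⱼ 0 (+0≤ n≤nⱼ))

  nL<spineMismatch+S+Nⱼ : suc (n * L) ≤ spineMismatch c i + (S + Nⱼ)
  nL<spineMismatch+S+Nⱼ with spineMismatch-positive c i
  ... | inj₁ (s₀ , s₁) = ≤-trans (subst (_≤ S + Nⱼ) (+-comm (n * L) 1) (nL<S+Nⱼ s₀ s₁)) (m≤n+m (S + Nⱼ) (spineMismatch c i))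
  ... | inj₂ positive  = +-mono-≤ positive nL≤S+Nⱼ

-- Upper bound

module UpperBound (L′ K′ j′ : ℕ) (J<L : suc j′ < suc L′) where

  open Words (suc K′) zero

  L J : ℕ
  L = suc L′
  J = suc j′

  -- Pages receive the first n words of ordered: all words of weight < J, one of weight J, and then
  -- any further words (each of weight ≤ L).
  Light Exact Heavy ordered : List (Word L)
  Light   = filter (λ v → weight v <? J) (allWords L)
  Exact   = filter (λ v → weight v ≟ℕ J) (allWords L)
  Heavy   = filter (λ v → J <? weight v) (allWords L)
  ordered = Light ++ Exact ++ Heavy

  length-ordered : length ordered ≡ suc (suc K′) ^ L
  length-ordered = begin
      length (Light ++ Exact ++ Heavy)
    ≡⟨ trans (length-++ Light) (cong (length Light +_) (length-++ Exact)) ⟩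
      length Light + (length Exact + length Heavy)
    ≡⟨ cong₂ _+_ (length-filter _ (allWords L)) (cong₂ _+_ (length-filter _ (allWords L)) (length-filter _ (allWords L))) ⟩
      sumList 𝟙< (allWords L) + (sumList 𝟙≡ (allWords L) + sumList 𝟙> (allWords L))
    ≡⟨ trans (sumList-+ 𝟙< (λ v → 𝟙≡ v + 𝟙> v) (allWords L)) (cong (sumList 𝟙< (allWords L) +_) (sumList-+ 𝟙≡ 𝟙> (allWords L))) ⟨
      sumList (λ v → 𝟙< v + (𝟙≡ v + 𝟙> v)) (allWords L)
    ≡⟨ sumList-cong (allWords L) (λ v → 𝟙-trichotomy (weight v) J) ⟩
      sumList (λ _ → 1) (allWords L)
    ≡⟨ allWords-size L ⟩
      suc (suc K′) ^ L ∎
    where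
    open ≡-Reasoning
    𝟙< 𝟙≡ 𝟙> : Word L → ℕ
    𝟙< v = 𝟙 (weight v <? J)
    𝟙≡ v = 𝟙 (weight v ≟ℕ J)
    𝟙> v = 𝟙 (J <? weight v)

  ordered-unique : Unique ordered
  ordered-unique = ++⁺ (unique-filter⁺ _ unique) (++⁺ (unique-filter⁺ _ unique) (unique-filter⁺ _ unique) Exact∩Heavy) Light∩rest
    where
    unique = allWords-unique L
    weight-Light : ∀ {v} → v ∈ Light → weight v < J
    weight-Light = proj₂ ∘ ∈-filter⁻ (λ v → weight v <? J) {xs = allWords L}
    weight-Exact : ∀ {v} → v ∈ Exact → weight v ≡ J
    weight-Exact = proj₂ ∘ ∈-filter⁻ (λ v → weight v ≟ℕ J) {xs = allWords L}
    weight-Heavy : ∀ {v} → v ∈ Heavy → J < weight v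
    weight-Heavy = proj₂ ∘ ∈-filter⁻ (λ v → J <? weight v) {xs = allWords L}
    Exact∩Heavy : ∀ {v} → ¬ (v ∈ Exact × v ∈ Heavy)
    Exact∩Heavy (v∈E , v∈H) = <-irrefl (sym (weight-Exact v∈E)) (weight-Heavy v∈H)
    Light∩rest : ∀ {v} → ¬ (v ∈ Light × v ∈ Exact ++ Heavy)
    Light∩rest (v∈L , v∈E++H) with ∈-++⁻ Exact v∈E++H
    ... | inj₁ v∈E = <-irrefl (weight-Exact v∈E) (weight-Light v∈L)
    ... | inj₂ v∈H = <-asym (weight-Light v∈L) (weight-Heavy v∈H)

  sumList-Light : ∀ (g : ℕ → ℕ) → sumList (g ∘ weight) Light ≡ ∑[ x ≤ j′ ] weightCount (suc K′) L x * g x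
  sumList-Light g = begin
      sumList (g ∘ weight) Light
    ≡⟨ sumList-filter _ (g ∘ weight) (allWords L) ⟩
      sumList (F ∘ weight) (allWords L)
    ≡⟨ sumList-allWords-weight L F ⟩
      ∑[ x ≤ L ] weightCount (suc K′) L x * F x
    ≡⟨ sumTo-vanishing _ (≤-trans (n≤1+n j′) (<⇒≤ J<L))
         (λ x j′<x → trans (cong (weightCount (suc K′) L x *_) (if-does-false (x <? J) (<⇒≱ j′<x ∘ s≤s⁻¹)))
                                  (*-zeroʳ (weightCount (suc K′) L x))) ⟩
      ∑[ x ≤ j′ ] weightCount (suc K′) L x * F x
    ≡⟨ sumTo-cong j′ (λ x x≤j′ → cong (weightCount (suc K′) L x *_) (if-does-true (x <? J) (s≤s x≤j′))) ⟩
      ∑[ x ≤ j′ ] weightCount (suc K′) L x * g x ∎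
    where
    open ≡-Reasoning
    F : ℕ → ℕ
    F x = if does (x <? J) then g x else 0

  nⱼ₋₁ Nⱼ₋₁ : ℕ
  nⱼ₋₁ = ∑[ x ≤ j′ ] weightCount (suc K′) L x
  Nⱼ₋₁ = ∑[ x ≤ j′ ] (L ∸ x) * weightCount (suc K′) L x

  length-Light : length Light ≡ nⱼ₋₁
  length-Light = trans (length-sumList Light) (trans (sumList-Light (λ _ → 1)) (sumTo-cong j′ (λ x _ → *-identityʳ _)))

  weight-Light+Nⱼ₋₁ : sumList weight Light + Nⱼ₋₁ ≡ L * length Light
  weight-Light+Nⱼ₋₁ = begin
      sumList weight Light + Nⱼ₋₁
    ≡⟨ cong (_+ Nⱼ₋₁) (sumList-Light id) ⟩
      (∑[ x ≤ j′ ] weightCount (suc K′) L x * x) + Nⱼ₋₁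
    ≡⟨ sumTo-+ j′ _ _ ⟨
      ∑[ x ≤ j′ ] (weightCount (suc K′) L x * x + (L ∸ x) * weightCount (suc K′) L x)
    ≡⟨ sumTo-cong j′ (λ x x≤j′ → trans (solve 3 (λ a b e → a :* b :+ e :* a := (b :+ e) :* a) refl (weightCount (suc K′) L x) x (L ∸ x))
         (cong (_* weightCount (suc K′) L x) (m+[n∸m]≡n (≤-trans x≤j′ (≤-trans (n≤1+n j′) (<⇒≤ J<L)))))) ⟩
      ∑[ x ≤ j′ ] L * weightCount (suc K′) L x
    ≡⟨ sumTo-*ˡ j′ L _ ⟩
      L * nⱼ₋₁
    ≡⟨ cong (L *_) length-Light ⟨
      L * length Light ∎
    where open ≡-Reasoning

  wordOfWeight : ∀ l x → x ≤ l → Word l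
  wordOfWeight l       zero    _         = Vec.replicate l zero
  wordOfWeight (suc l) (suc x) (s≤s x≤l) = suc zero ∷ wordOfWeight l x x≤l

  weight-wordOfWeight : ∀ l x x≤l → weight (wordOfWeight l x x≤l) ≡ x
  weight-wordOfWeight l       zero    _         = weight-replicate l
    where
    weight-replicate : ∀ l → weight (Vec.replicate l zero) ≡ 0
    weight-replicate zero    = refl
    weight-replicate (suc l) = weight-replicate l
  weight-wordOfWeight (suc l) (suc x) (s≤s x≤l) = cong suc (weight-wordOfWeight l x x≤l)

  Exact-head : ∃ λ x → ∃ λ rest → Exact ≡ x ∷ rest × weight x ≡ J
  Exact-head with ∈⇒∷ (∈-filter⁺ (λ v → weight v ≟ℕ J) (∈-allWords (wordOfWeight L J (<⇒≤ J<L))) (weight-wordOfWeight L J (<⇒≤ J<L)))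
  ... | x , rest , eq = x , rest , eq ,
        proj₂ (∈-filter⁻ (λ v → weight v ≟ℕ J) {xs = allWords L} (subst (x ∈_) (sym eq) (here refl)))

  module Colouring (n′ : ℕ) (nⱼ₋₁<n : nⱼ₋₁ < suc (suc n′)) (n≤k^L : suc (suc n′) ≤ suc (suc K′) ^ L) where

    n m : ℕ
    n = suc (suc n′)
    m = suc (suc L)

    word : Fin n → Word L
    word p = lookupOr (Vec.replicate L zero) ordered (toℕ p)

    W : ℕ
    W = ∑[ p < n ] weight (word p)

    n≤length : n ≤ length ordered
    n≤length = subst (n ≤_) (sym length-ordered) n≤k^L

    word-injective : ∀ {p q} → word p ≡ word q → p ≡ q
    word-injective {p} {q} eq = toℕ-injective (lookupOr-injective _ ordered-unique
      (<-≤-trans (toℕ<n p) n≤length) (<-≤-trans (toℕ<n q) n≤length) eq)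

    colouring : Coloring n m (suc (suc K′))
    colouring (spine zero)       = zero
    colouring (spine (suc zero)) = suc zero
    colouring (page p t)         = lookup (word p) t

    pageWord-colouring : ∀ p → pageWord colouring p ≡ word p
    pageWord-colouring p = tabulate∘lookup (word p)

    colouring-distinguishing : IsDistinguishing colouring
    colouring-distinguishing = spines≢∧pageWord-injective⇒distinguishing colouring (λ ())
      (λ {p} {q} eq → word-injective (trans (sym (pageWord-colouring p)) (trans eq (pageWord-colouring q))))

    outsideClass-colouring : outsideClass colouring zero ≡ 1 + W
    outsideClass-colouring = trans (outsideClass-decomposition colouring zero)
      (cong (1 +_) (sumFin-cong n (cong weight ∘ pageWord-colouring)))

    P t : ℕ
    P = length Light
    t = n ∸ suc P

    n≡P+1+t : n ≡ P + suc t
    n≡P+1+t = trans (sym (m+[n∸m]≡n (subst (_< n) (sym length-Light) nⱼ₋₁<n))) (sym (+-suc P t))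

    W≤ : W ≤ sumList weight Light + (J + t * L)
    W≤ with Exact-head
    ... | x , rest , Exact≡x∷rest , weight-x = begin
        ∑[ p < n ] weight (word p)
      ≡⟨ sumFin-lookupOr _ weight n ordered n≤length ⟩
        sumList weight (take n ordered)
      ≡⟨ cong₂ (λ a E → sumList weight (take a (Light ++ E ++ Heavy))) n≡P+1+t Exact≡x∷rest ⟩
        sumList weight (take (P + suc t) (Light ++ x ∷ rest ++ Heavy))
      ≡⟨ sumList-take-++ weight Light (x ∷ rest ++ Heavy) (suc t) ⟩
        sumList weight Light + (weight x + sumList weight (take t (rest ++ Heavy)))
      ≤⟨ +-monoʳ-≤ (sumList weight Light) (+-mono-≤ (≤-reflexive weight-x) (sumList-take-≤ weight weight≤length t _)) ⟩
        sumList weight Light + (J + t * L) ∎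
      where open ≤-Reasoning

    W+Nⱼ₋₁<nL : W + Nⱼ₋₁ < n * L
    W+Nⱼ₋₁<nL = begin-strict
        W + Nⱼ₋₁
      ≤⟨ +-monoˡ-≤ Nⱼ₋₁ W≤ ⟩
        sumList weight Light + (J + t * L) + Nⱼ₋₁
      ≡⟨ solve 3 (λ a b e → a :+ b :+ e := (a :+ e) :+ b) refl (sumList weight Light) (J + t * L) Nⱼ₋₁ ⟩
        (sumList weight Light + Nⱼ₋₁) + (J + t * L)
      ≡⟨ cong (_+ (J + t * L)) weight-Light+Nⱼ₋₁ ⟩
        L * P + (J + t * L)
      <⟨ +-monoʳ-< (L * P) (+-monoˡ-< (t * L) J<L) ⟩
        L * P + (L + t * L)
      ≡⟨ solve 3 (λ l p t → l :* p :+ (l :+ t :* l) := (p :+ (con 1 :+ t)) :* l) refl L P t ⟩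
        (P + suc t) * L
      ≡⟨ cong (_* L) n≡P+1+t ⟨
        n * L ∎
      where open ≤-Reasoning

smallN≡sumTo : ∀ m K j → smallN m (suc K) j ≡ ∑[ x ≤ j ] weightCount K (m ∸ 2) x
smallN≡sumTo m K zero    = refl
smallN≡sumTo m K (suc j) = cong (_+ weightCount K (m ∸ 2) (suc j)) (smallN≡sumTo m K j)

bigN≡sumTo : ∀ m K j → bigN m (suc K) j ≡ ∑[ x ≤ j ] (m ∸ 2 ∸ x) * weightCount K (m ∸ 2) x
bigN≡sumTo m K zero    = *-assoc (m ∸ 2) _ _
bigN≡sumTo m K (suc j) = cong₂ _+_ (bigN≡sumTo m K j) (*-assoc (m ∸ 2 ∸ suc j) _ _)

binomial : ∀ K L → ∑[ x ≤ L ] weightCount K L x ≡ suc K ^ L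
binomial K L = begin
    ∑[ x ≤ L ] weightCount K L x          ≡⟨ sumTo-cong L (λ x _ → *-identityʳ _) ⟨
    ∑[ x ≤ L ] weightCount K L x * 1      ≡⟨ sumList-allWords-weight L (λ _ → 1) ⟨
    sumList (λ _ → 1) (allWords L)        ≡⟨ allWords-size L ⟩
    suc K ^ L                             ∎
  where
  open ≡-Reasoning
  open Words K zero

smallN-last : ∀ L′ K → smallN (3 + L′) (suc K) L′ ≡ suc K ^ suc L′ ∸ K ^ suc L′
smallN-last L′ K = begin
    smallN (3 + L′) (suc K) L′                                      ≡⟨ m+n∸n≡m _ (K ^ suc L′) ⟨
    smallN (3 + L′) (suc K) L′ + K ^ suc L′ ∸ K ^ suc L′            ≡⟨ cong (λ z → smallN (3 + L′) (suc K) L′ + z ∸ K ^ suc L′)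
                                                                         (trans (sym (*-identityˡ _)) (cong (_* K ^ suc L′) (sym (nCn≡1 (suc L′))))) ⟩
    smallN (3 + L′) (suc K) (suc L′) ∸ K ^ suc L′                   ≡⟨ cong (_∸ K ^ suc L′) (trans (smallN≡sumTo (3 + L′) K (suc L′)) (binomial K (suc L′))) ⟩
    suc K ^ suc L′ ∸ K ^ suc L′                                     ∎
  where open ≡-Reasoning

j<pageLength : ∀ {n L′ K j} → n < suc K ^ suc L′ ∸ K ^ suc L′ →
  (∀ j′ → j′ < j → smallN (3 + L′) (suc K) j′ < n) → j < suc L′
j<pageLength {n} {L′} {K} {j} n<top minimal with j <? suc L′
... | yes j<L = j<L
... | no j≮L  = ⊥-elim (<-asym (minimal L′ (≮⇒≥ j≮L)) (subst (n <_) (sym (smallN-last L′ K)) n<top))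

∸-∸1-≤ : ∀ a N o → a ≤ N + 1 + o → a ∸ N ∸ 1 ≤ o
∸-∸1-≤ a N o h = subst (_≤ o) (sym (∸-+-assoc a N 1)) (m≤n+o⇒m∸n≤o a (N + 1) h)

<-∸-∸1 : ∀ a N o → suc o + (N + 1) ≤ a → o < a ∸ N ∸ 1
<-∸-∸1 a N o h = subst (o <_) (sym (∸-+-assoc a N 1)) (m+n≤o⇒m≤o∸n (suc o) h)

outsideClass-lowerBound : ∀ {n m K j} (c : Coloring n m (suc K)) i → IsDistinguishing c → j < m ∸ 2 →
  n ≤ smallN m (suc K) j → numVtx n m ∸ bigN m (suc K) j ∸ 1 ≤ outsideClass c i
outsideClass-lowerBound {n} {m} {K} {j} c i dist j<L n≤nⱼ = ∸-∸1-≤ (numVtx n m) _ _ (begin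
    2 + n * (m ∸ 2)                              ≤⟨ s≤s nL<spineMismatch+S+Nⱼ ⟩
    suc (spineMismatch c i + (S + Nⱼ))           ≡⟨ solve 3 (λ a b c → con 1 :+ (a :+ (b :+ c)) := c :+ con 1 :+ (a :+ b)) refl (spineMismatch c i) S Nⱼ ⟩
    Nⱼ + 1 + (spineMismatch c i + S)             ≡⟨ cong₂ (λ N o → N + 1 + o) (sym (bigN≡sumTo m K j)) (sym (outsideClass-decomposition c i)) ⟩
    bigN m (suc K) j + 1 + outsideClass c i      ∎)
  where
  open LowerBound c i dist j<L (subst (n ≤_) (smallN≡sumTo m K j) n≤nⱼ)
  open ≤-Reasoning

outsideClass-upperBound : ∀ n′ L′ K′ j′ → suc j′ < suc L′ → smallN (3 + L′) (2 + K′) j′ < 2 + n′ → 2 + n′ ≤ (2 + K′) ^ suc L′ →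
  ∃ λ (c : Coloring (2 + n′) (3 + L′) (2 + K′)) → IsDistinguishing c ×
    outsideClass c zero < numVtx (2 + n′) (3 + L′) ∸ bigN (3 + L′) (2 + K′) j′ ∸ 1
outsideClass-upperBound n′ L′ K′ j′ J<L nⱼ₋₁<n n≤k^L =
  colouring , colouring-distinguishing , <-∸-∸1 (numVtx n m) _ _ (begin
    suc (outsideClass colouring zero) + (bigN m (2 + K′) j′ + 1)  ≡⟨ cong₂ (λ o N → suc o + (N + 1)) outsideClass-colouring (bigN≡sumTo m (suc K′) j′) ⟩
    2 + W + (Nⱼ₋₁ + 1)                                           ≡⟨ solve 2 (λ w N → con 2 :+ w :+ (N :+ con 1) := con 2 :+ (con 1 :+ (w :+ N))) refl W Nⱼ₋₁ ⟩
    2 + suc (W + Nⱼ₋₁)                                           ≤⟨ +-monoʳ-≤ 2 W+Nⱼ₋₁<nL ⟩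
    2 + n * L                                                    ∎)
  where
  open UpperBound L′ K′ j′ J<L
  open Colouring n′ (subst (_< 2 + n′) (smallN≡sumTo (3 + L′) (suc K′) j′) nⱼ₋₁<n) n≤k^L
  open ≤-Reasoning

mainTheorem10 : (n m k j r : ℕ) → 2 ≤ n → 4 ≤ m → IsDist n m k
    → n < k ^ (m ∸ 2) ∸ (k ∸ 1) ^ (m ∸ 2)
    → n ≤ smallN m k j → (∀ j′ → j′ < j → smallN m k j′ < n)
    → IsPaintCost n m k r
    → (numVtx n m ∸ bigN m k j ∸ 1 ≤ r) × (r < numVtx n m ∸ bigN m k (j ∸ 1) ∸ 1)
mainTheorem10 (suc (suc n′)) (suc (suc (suc (suc M′)))) (suc (suc K′)) (suc j′) r (s≤s (s≤s z≤n)) (s≤s (s≤s (s≤s (s≤s z≤n))))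
              _ n<top n≤nⱼ minimal ((c , i , dist , refl) , cheapest) =
  let j<L = j<pageLength n<top minimal
      colouring , distinguishing , upper = outsideClass-upperBound n′ (suc M′) K′ j′ j<L (minimal j′ ≤-refl)
                                             (≤-trans (<⇒≤ n<top) (m∸n≤m _ ((1 + K′) ^ (2 + M′))))
  in  outsideClass-lowerBound c i dist j<L n≤nⱼ , ≤-<-trans (cheapest colouring zero distinguishing) upper
mainTheorem10 (suc (suc _)) (suc (suc (suc (suc _)))) zero _ _ (s≤s (s≤s z≤n)) (s≤s (s≤s (s≤s (s≤s z≤n)))) _ () _ _ _
mainTheorem10 (suc (suc n′)) (suc (suc (suc (suc M′)))) (suc zero) _ _ (s≤s (s≤s z≤n)) (s≤s (s≤s (s≤s (s≤s z≤n)))) _ n<top _ _ _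
  with s≤s () ← subst (2 + n′ <_) (^-zeroˡ (2 + M′)) n<top
mainTheorem10 (suc (suc _)) (suc (suc (suc (suc _)))) (suc (suc _)) zero _ (s≤s (s≤s z≤n)) (s≤s (s≤s (s≤s (s≤s z≤n)))) _ _ (s≤s ()) _ _
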